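{- Let $(x,y)\mapsto(w_1,w_2)$ and $(w_1,w_2)\mapsto(u_1,u_2)$ be holomorphic maps, and let $u_1,u_2$ also denote the composite functions of $(x,y)$. Then $$M(w_1,w_2;x,y)\cdot M(u_1,u_2;w_1,w_2)=M(u_1,u_2;x,y),$$ where the entries of $M(u_1,u_2;w_1,w_2)$ are evaluated at $(w_1(x,y),w_2(x,y))$.
   Context: For a holomorphic map $(x,y)\mapsto(w_1,w_2)$ put $a=\frac{\partial w_1}{\partial x}$, $b=\frac{\partial w_2}{\partial x}$, $c=\frac{\partial w_1}{\partial y}$, $d=\frac{\partial w_2}{\partial y}$ and define the $4\times4$ matrix $$M(w_1,w_2;x,y)=\begin{pmatrix}a^3&-b^3&a^2b&-ab^2\\-c^3&d^3&-c^2d&cd^2\\3a^2c&-3b^2d&a^2d+2abc&-(b^2c+2abd)\\-3ac^2&3bd^2&-(bc^2+2acd)&ad^2+2bcd\end{pmatrix}.$$ $M(u_1,u_2;w_1,w_2)$ and $M(u_1,u_2;x,y)$ are defined in the same way from the corresponding partial derivatives. -}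

module Defs where

open import Level using (_⊔_)
open import Algebra.Bundles using (CommutativeRing)
open import Data.Fin using (Fin; zero; suc)
open import Data.Product using (_×_)

module Jet {c ℓ} (K : CommutativeRing c ℓ) where
  open CommutativeRing K hiding (zero)

  Fun₂ : Set c
  Fun₂ = Carrier → Carrier → Carrier

  Mat4 : Set c
  Mat4 = Fin 4 → Fin 4 → Carrier

  3# : Carrier
  3# = 1# + 1# + 1#

  _⊗_ : Mat4 → Mat4 → Mat4
  (A ⊗ B) i j =
    A i zero * B zero j + A i (suc zero) * B (suc zero) j
    + A i (suc (suc zero)) * B (suc (suc zero)) j
    + A i (suc (suc (suc zero))) * B (suc (suc (suc zero))) j

  Mabcd : Carrier → Carrier → Carrier → Carrier → Mat4
  Mabcd a b c d zero zero = a * a * a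
  Mabcd a b c d zero (suc zero) = - (b * b * b)
  Mabcd a b c d zero (suc (suc zero)) = a * a * b
  Mabcd a b c d zero (suc (suc (suc zero))) = - (a * b * b)
  Mabcd a b c d (suc zero) zero = - (c * c * c)
  Mabcd a b c d (suc zero) (suc zero) = d * d * d
  Mabcd a b c d (suc zero) (suc (suc zero)) = - (c * c * d)
  Mabcd a b c d (suc zero) (suc (suc (suc zero))) = c * d * d
  Mabcd a b c d (suc (suc zero)) zero = 3# * a * a * c
  Mabcd a b c d (suc (suc zero)) (suc zero) = - (3# * b * b * d)
  Mabcd a b c d (suc (suc zero)) (suc (suc zero)) = a * a * d + (1# + 1#) * a * b * c
  Mabcd a b c d (suc (suc zero)) (suc (suc (suc zero))) = - (b * b * c + (1# + 1#) * a * b * d)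
  Mabcd a b c d (suc (suc (suc zero))) zero = - (3# * a * c * c)
  Mabcd a b c d (suc (suc (suc zero))) (suc zero) = 3# * b * d * d
  Mabcd a b c d (suc (suc (suc zero))) (suc (suc zero)) = - (b * c * c + (1# + 1#) * a * c * d)
  Mabcd a b c d (suc (suc (suc zero))) (suc (suc (suc zero))) = a * d * d + (1# + 1#) * b * c * d

  -- M(w₁,w₂;x,y) evaluated at the point (x,y), where ∂₁, ∂₂ are the partial
  -- derivative operators in the first / second variable.
  M : (∂₁ ∂₂ : Fun₂ → Fun₂) → (w₁ w₂ : Fun₂) → Carrier → Carrier → Mat4
  M ∂₁ ∂₂ w₁ w₂ x y = Mabcd (∂₁ w₁ x y) (∂₁ w₂ x y) (∂₂ w₁ x y) (∂₂ w₂ x y)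

  _∘₂_,_ : Fun₂ → Fun₂ → Fun₂ → Fun₂
  (u ∘₂ w₁ , w₂) x y = u (w₁ x y) (w₂ x y)

  ChainRule : (∂₁ ∂₂ : Fun₂ → Fun₂) → (u w₁ w₂ : Fun₂) → Set (c ⊔ ℓ)
  ChainRule ∂₁ ∂₂ u w₁ w₂ = ∀ x y →
      (∂₁ (u ∘₂ w₁ , w₂) x y ≈ ∂₁ u (w₁ x y) (w₂ x y) * ∂₁ w₁ x y
                              + ∂₂ u (w₁ x y) (w₂ x y) * ∂₁ w₂ x y)
    × (∂₂ (u ∘₂ w₁ , w₂) x y ≈ ∂₁ u (w₁ x y) (w₂ x y) * ∂₂ w₁ x y
                              + ∂₂ u (w₁ x y) (w₂ x y) * ∂₂ w₂ x y)

Eq : ∀ {c ℓ} (K : CommutativeRing c ℓ) → CommutativeRing.Carrier K → CommutativeRing.Carrier K → Set ℓ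
Eq K = CommutativeRing._≈_ K

-- The Jacobian of the composite is the product of the Jacobians (chain rule), so it
-- suffices that J ↦ M(J) is multiplicative on 2×2 matrices.  Up to conjugation by the
-- diagonal matrix S = diag(1, -1, 1, -1), M(J) is the third symmetric power of J: with
-- p = a s + b t and q = c s + d t, the rows of S M(J) S are the coordinates of
-- p³, q³, 3p²q, 3pq² in the basis s³, t³, 3s²t, 3st².  Conjugation by S commutes with the
-- product since S² = 1, and the sign-free matrix is multiplicative by a polynomial identity
-- in eight variables without negation, which the natural-coefficient solver checks entrywise.
module Submission where

open import Algebra.Bundles using (CommutativeRing)
open import Data.Fin using (Fin)
open import Data.Fin.Patterns using (0F; 1F; 2F; 3F)
open import Data.Product using (_×_; proj₁; proj₂)
open import Data.Sign as Sign using (Sign) renaming (_*_ to _·_)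
open import Data.Sign.Properties using (s*s≡+) renaming (*-assoc to ·-assoc)
open import Data.Vec using (_∷_; [])
open import Data.Vec.N-ary using (N-ary)
open import Data.Vec.Relation.Binary.Pointwise.Inductive as Pointwise using (Pointwise; _∷_; [])
import Relation.Binary.PropositionalEquality as ≡
open ≡ using (_≡_)
open import Defs

module _ {c ℓ} (K : CommutativeRing c ℓ) where
  open CommutativeRing K hiding (zero)
  open Jet K
  open import Algebra.Properties.Ring ring using (-‿distribˡ-*; -‿distribʳ-*; -‿involutive)
  open import Algebra.Properties.AbelianGroup +-abelianGroup using (⁻¹-∙-comm)
  open import Algebra.Properties.Semiring.Exp semiring using (^-congˡ)
  open import Algebra.Solver.Ring.NaturalCoefficients.Default commutativeSemiring
    using (Polynomial; op; [+]; [*]; con; var; _:^_; :-_; _:+_; _:*_; ⟦_⟧; solve; _:=_)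
  open import Relation.Binary.Reasoning.Setoid setoid

  infixr 8 _◃_

  _◃_ : Sign → Carrier → Carrier
  Sign.+ ◃ x = x
  Sign.- ◃ x = - x

  ◃-cong : ∀ s {x y} → x ≈ y → s ◃ x ≈ s ◃ y
  ◃-cong Sign.+ x≈y = x≈y
  ◃-cong Sign.- x≈y = -‿cong x≈y

  ◃-distrib-+ : ∀ s x y → s ◃ (x + y) ≈ s ◃ x + s ◃ y
  ◃-distrib-+ Sign.+ x y = refl
  ◃-distrib-+ Sign.- x y = sym (⁻¹-∙-comm x y)

  ◃-*-◃ : ∀ s t x y → (s ◃ x) * (t ◃ y) ≈ (s · t) ◃ (x * y)
  ◃-*-◃ Sign.+ Sign.+ x y = refl
  ◃-*-◃ Sign.+ Sign.- x y = sym (-‿distribʳ-* x y)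
  ◃-*-◃ Sign.- Sign.+ x y = sym (-‿distribˡ-* x y)
  ◃-*-◃ Sign.- Sign.- x y = begin
    - x * - y     ≈⟨ -‿distribˡ-* x (- y) ⟨
    - (x * - y)   ≈⟨ -‿cong (-‿distribʳ-* x y) ⟨
    - (- (x * y)) ≈⟨ -‿involutive (x * y) ⟩
    x * y         ∎

  sign-cancel : ∀ s t u → (s · t) · (t · u) ≡ s · u
  sign-cancel s t u = ≡.trans (·-assoc s t (t · u)) (≡.cong (s ·_) t·[t·u]≡u)
    where
    t·[t·u]≡u : t · (t · u) ≡ u
    t·[t·u]≡u = ≡.trans (≡.sym (·-assoc t t u)) (≡.cong (_· u) (s*s≡+ t))

  conj : (Fin 4 → Sign) → Mat4 → Mat4
  conj ε A i j = (ε i · ε j) ◃ A i j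

  infix 4 _≋_

  _≋_ : Mat4 → Mat4 → Set ℓ
  A ≋ B = ∀ i j → A i j ≈ B i j

  ⊗-cong : ∀ {A A′ B B′} → A ≋ A′ → B ≋ B′ → A ⊗ B ≋ A′ ⊗ B′
  ⊗-cong A≈ B≈ i j = +-cong (+-cong (+-cong (term 0F) (term 1F)) (term 2F)) (term 3F)
    where term = λ k → *-cong (A≈ i k) (B≈ k j)

  conj-distrib-⊗ : ∀ ε A B → conj ε A ⊗ conj ε B ≋ conj ε (A ⊗ B)
  conj-distrib-⊗ ε A B i j = begin
    (conj ε A ⊗ conj ε B) i j
      ≈⟨ +-cong (+-cong (+-cong (term 0F) (term 1F)) (term 2F)) (term 3F) ⟩
    s ◃ t 0F + s ◃ t 1F + s ◃ t 2F + s ◃ t 3F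
      ≈⟨ +-cong (+-cong (◃-distrib-+ s _ _) refl) refl ⟨
    s ◃ (t 0F + t 1F) + s ◃ t 2F + s ◃ t 3F
      ≈⟨ +-cong (◃-distrib-+ s _ _) refl ⟨
    s ◃ (t 0F + t 1F + t 2F) + s ◃ t 3F
      ≈⟨ ◃-distrib-+ s _ _ ⟨
    s ◃ (A ⊗ B) i j ∎
    where
    s = ε i · ε j
    t = λ k → A i k * B k j
    term : ∀ k → conj ε A i k * conj ε B k j ≈ s ◃ t k
    term k = trans (◃-*-◃ (ε i · ε k) (ε k · ε j) (A i k) (B k j))
                   (reflexive (≡.cong (_◃ t k) (sign-cancel (ε i) (ε k) (ε j))))

  ⟦⟧-cong : ∀ {n} (p : Polynomial n) {ρ ρ′} → Pointwise _≈_ ρ ρ′ → ⟦ p ⟧ ρ ≈ ⟦ p ⟧ ρ′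
  ⟦⟧-cong (op [+] p q) ρ≈ρ′ = +-cong (⟦⟧-cong p ρ≈ρ′) (⟦⟧-cong q ρ≈ρ′)
  ⟦⟧-cong (op [*] p q) ρ≈ρ′ = *-cong (⟦⟧-cong p ρ≈ρ′) (⟦⟧-cong q ρ≈ρ′)
  ⟦⟧-cong (con k)      ρ≈ρ′ = refl
  ⟦⟧-cong (var x)      ρ≈ρ′ = Pointwise.lookup ρ≈ρ′ x
  ⟦⟧-cong (p :^ k)     ρ≈ρ′ = ^-congˡ k (⟦⟧-cong p ρ≈ρ′)
  -- the semiring solver interprets negation as the identity
  ⟦⟧-cong (:- p)       ρ≈ρ′ = ⟦⟧-cong p ρ≈ρ′

  2ᴾ 3ᴾ : ∀ {n} → Polynomial n
  2ᴾ = con 1 :+ con 1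
  3ᴾ = 2ᴾ :+ con 1

  Sym³ᴾ : ∀ {n} → Polynomial n → Polynomial n → Polynomial n → Polynomial n → Fin 4 → Fin 4 → Polynomial n
  Sym³ᴾ a b c d 0F 0F = a :* a :* a
  Sym³ᴾ a b c d 0F 1F = b :* b :* b
  Sym³ᴾ a b c d 0F 2F = a :* a :* b
  Sym³ᴾ a b c d 0F 3F = a :* b :* b
  Sym³ᴾ a b c d 1F 0F = c :* c :* c
  Sym³ᴾ a b c d 1F 1F = d :* d :* d
  Sym³ᴾ a b c d 1F 2F = c :* c :* d
  Sym³ᴾ a b c d 1F 3F = c :* d :* d
  Sym³ᴾ a b c d 2F 0F = 3ᴾ :* a :* a :* c
  Sym³ᴾ a b c d 2F 1F = 3ᴾ :* b :* b :* d
  Sym³ᴾ a b c d 2F 2F = a :* a :* d :+ 2ᴾ :* a :* b :* c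
  Sym³ᴾ a b c d 2F 3F = b :* b :* c :+ 2ᴾ :* a :* b :* d
  Sym³ᴾ a b c d 3F 0F = 3ᴾ :* a :* c :* c
  Sym³ᴾ a b c d 3F 1F = 3ᴾ :* b :* d :* d
  Sym³ᴾ a b c d 3F 2F = b :* c :* c :+ 2ᴾ :* a :* c :* d
  Sym³ᴾ a b c d 3F 3F = a :* d :* d :+ 2ᴾ :* b :* c :* d

  -- Defined by evaluating the syntax, so that every solver goal below is definitionally an
  -- entry of Sym³.
  Sym³ : Carrier → Carrier → Carrier → Carrier → Mat4
  Sym³ a b c d i j = ⟦ Sym³ᴾ (var 0F) (var 1F) (var 2F) (var 3F) i j ⟧ (a ∷ b ∷ c ∷ d ∷ [])

  Sym³-cong : ∀ {a b c d a′ b′ c′ d′} → a ≈ a′ → b ≈ b′ → c ≈ c′ → d ≈ d′ →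
              Sym³ a b c d ≋ Sym³ a′ b′ c′ d′
  Sym³-cong a≈ b≈ c≈ d≈ i j = ⟦⟧-cong (Sym³ᴾ _ _ _ _ i j) (a≈ ∷ b≈ ∷ c≈ ∷ d≈ ∷ [])

  _⊗ᴾ_ : ∀ {n} → (Fin 4 → Fin 4 → Polynomial n) → (Fin 4 → Fin 4 → Polynomial n) → Fin 4 → Fin 4 → Polynomial n
  (A ⊗ᴾ B) i j = A i 0F :* B 0F j :+ A i 1F :* B 1F j :+ A i 2F :* B 2F j :+ A i 3F :* B 3F j

  Sym³-⊗ᴾ : Fin 4 → Fin 4 → N-ary 8 (Polynomial 8) (Polynomial 8 × Polynomial 8)
  Sym³-⊗ᴾ i j a b c d a′ b′ c′ d′ =
    (Sym³ᴾ a b c d ⊗ᴾ Sym³ᴾ a′ b′ c′ d′) i j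
      := Sym³ᴾ (a :* a′ :+ b :* c′) (a :* b′ :+ b :* d′) (c :* a′ :+ d :* c′) (c :* b′ :+ d :* d′) i j

  Sym³-⊗ : ∀ i j a b c d a′ b′ c′ d′ →
           (Sym³ a b c d ⊗ Sym³ a′ b′ c′ d′) i j
             ≈ Sym³ (a * a′ + b * c′) (a * b′ + b * d′) (c * a′ + d * c′) (c * b′ + d * d′) i j
  Sym³-⊗ 0F 0F = solve 8 (Sym³-⊗ᴾ 0F 0F) refl
  Sym³-⊗ 0F 1F = solve 8 (Sym³-⊗ᴾ 0F 1F) refl
  Sym³-⊗ 0F 2F = solve 8 (Sym³-⊗ᴾ 0F 2F) refl
  Sym³-⊗ 0F 3F = solve 8 (Sym³-⊗ᴾ 0F 3F) refl
  Sym³-⊗ 1F 0F = solve 8 (Sym³-⊗ᴾ 1F 0F) refl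
  Sym³-⊗ 1F 1F = solve 8 (Sym³-⊗ᴾ 1F 1F) refl
  Sym³-⊗ 1F 2F = solve 8 (Sym³-⊗ᴾ 1F 2F) refl
  Sym³-⊗ 1F 3F = solve 8 (Sym³-⊗ᴾ 1F 3F) refl
  Sym³-⊗ 2F 0F = solve 8 (Sym³-⊗ᴾ 2F 0F) refl
  Sym³-⊗ 2F 1F = solve 8 (Sym³-⊗ᴾ 2F 1F) refl
  Sym³-⊗ 2F 2F = solve 8 (Sym³-⊗ᴾ 2F 2F) refl
  Sym³-⊗ 2F 3F = solve 8 (Sym³-⊗ᴾ 2F 3F) refl
  Sym³-⊗ 3F 0F = solve 8 (Sym³-⊗ᴾ 3F 0F) refl
  Sym³-⊗ 3F 1F = solve 8 (Sym³-⊗ᴾ 3F 1F) refl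
  Sym³-⊗ 3F 2F = solve 8 (Sym³-⊗ᴾ 3F 2F) refl
  Sym³-⊗ 3F 3F = solve 8 (Sym³-⊗ᴾ 3F 3F) refl

  alternating : Fin 4 → Sign
  alternating 0F = Sign.+
  alternating 1F = Sign.-
  alternating 2F = Sign.+
  alternating 3F = Sign.-

  Mabcd≋conj-Sym³ : ∀ {a b c d} → Mabcd a b c d ≋ conj alternating (Sym³ a b c d)
  Mabcd≋conj-Sym³ 0F 0F = refl
  Mabcd≋conj-Sym³ 0F 1F = refl
  Mabcd≋conj-Sym³ 0F 2F = refl
  Mabcd≋conj-Sym³ 0F 3F = refl
  Mabcd≋conj-Sym³ 1F 0F = refl
  Mabcd≋conj-Sym³ 1F 1F = refl
  Mabcd≋conj-Sym³ 1F 2F = refl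
  Mabcd≋conj-Sym³ 1F 3F = refl
  Mabcd≋conj-Sym³ 2F 0F = refl
  Mabcd≋conj-Sym³ 2F 1F = refl
  Mabcd≋conj-Sym³ 2F 2F = refl
  Mabcd≋conj-Sym³ 2F 3F = refl
  Mabcd≋conj-Sym³ 3F 0F = refl
  Mabcd≋conj-Sym³ 3F 1F = refl
  Mabcd≋conj-Sym³ 3F 2F = refl
  Mabcd≋conj-Sym³ 3F 3F = refl

  Mabcd-cong : ∀ {a b c d a′ b′ c′ d′} → a ≈ a′ → b ≈ b′ → c ≈ c′ → d ≈ d′ →
               Mabcd a b c d ≋ Mabcd a′ b′ c′ d′
  Mabcd-cong {a} {b} {c} {d} {a′} {b′} {c′} {d′} a≈ b≈ c≈ d≈ i j = begin
    Mabcd a b c d i j                          ≈⟨ Mabcd≋conj-Sym³ i j ⟩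
    conj alternating (Sym³ a b c d) i j        ≈⟨ ◃-cong (alternating i · alternating j) (Sym³-cong a≈ b≈ c≈ d≈ i j) ⟩
    conj alternating (Sym³ a′ b′ c′ d′) i j    ≈⟨ Mabcd≋conj-Sym³ i j ⟨
    Mabcd a′ b′ c′ d′ i j                      ∎

  Mabcd-⊗ : ∀ {a b c d a′ b′ c′ d′} →
            Mabcd a b c d ⊗ Mabcd a′ b′ c′ d′
              ≋ Mabcd (a * a′ + b * c′) (a * b′ + b * d′) (c * a′ + d * c′) (c * b′ + d * d′)
  Mabcd-⊗ {a} {b} {c} {d} {a′} {b′} {c′} {d′} i j = begin
    (Mabcd a b c d ⊗ Mabcd a′ b′ c′ d′) i j
      ≈⟨ ⊗-cong Mabcd≋conj-Sym³ Mabcd≋conj-Sym³ i j ⟩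
    (conj alternating (Sym³ a b c d) ⊗ conj alternating (Sym³ a′ b′ c′ d′)) i j
      ≈⟨ conj-distrib-⊗ alternating (Sym³ a b c d) (Sym³ a′ b′ c′ d′) i j ⟩
    conj alternating (Sym³ a b c d ⊗ Sym³ a′ b′ c′ d′) i j
      ≈⟨ ◃-cong (alternating i · alternating j) (Sym³-⊗ i j a b c d a′ b′ c′ d′) ⟩
    conj alternating (Sym³ (a * a′ + b * c′) (a * b′ + b * d′) (c * a′ + d * c′) (c * b′ + d * d′)) i j
      ≈⟨ Mabcd≋conj-Sym³ i j ⟨
    Mabcd (a * a′ + b * c′) (a * b′ + b * d′) (c * a′ + d * c′) (c * b′ + d * d′) i j ∎

proposition2p8 : ∀ {c ℓ} (K : CommutativeRing c ℓ) → let open Jet K in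
    (∂₁ ∂₂ : Fun₂ → Fun₂) (w₁ w₂ u₁ u₂ : Fun₂) →
    ChainRule ∂₁ ∂₂ u₁ w₁ w₂ → ChainRule ∂₁ ∂₂ u₂ w₁ w₂ →
    ∀ (x y : CommutativeRing.Carrier K) (i j : Fin 4) →
    Eq K ((M ∂₁ ∂₂ w₁ w₂ x y ⊗ M ∂₁ ∂₂ u₁ u₂ (w₁ x y) (w₂ x y)) i j)
    (M ∂₁ ∂₂ (u₁ ∘₂ w₁ , w₂) (u₂ ∘₂ w₁ , w₂) x y i j)
proposition2p8 K ∂₁ ∂₂ w₁ w₂ u₁ u₂ chain₁ chain₂ x y i j =
  trans (Mabcd-⊗ K i j)
        (Mabcd-cong K (by-chain-rule (proj₁ (chain₁ x y))) (by-chain-rule (proj₁ (chain₂ x y)))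
                      (by-chain-rule (proj₂ (chain₁ x y))) (by-chain-rule (proj₂ (chain₂ x y))) i j)
  where
  open CommutativeRing K using (Carrier; _≈_; _+_; _*_; trans; sym; +-cong; *-comm)

  by-chain-rule : ∀ {z p q r s : Carrier} → z ≈ p * q + r * s → q * p + s * r ≈ z
  by-chain-rule z≈ = sym (trans z≈ (+-cong (*-comm _ _) (*-comm _ _)))
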